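{- For $t=1$, the greedy algorithm (repeatedly choose a maximum $1$-sparse set of the subgraph induced by the not-yet-colored vertices and assign all its vertices a new color, until all vertices are colored) outputs an optimal $1$-relaxed coloring of every complete multipartite graph, i.e., it uses exactly $\chi_1(G)$ colors.
   Context: A complete multipartite graph has its vertex set partitioned into nonempty parts, two vertices adjacent iff in different parts. A set $S$ of vertices is $t$-sparse if the induced subgraph on $S$ has maximum degree at most $t$. A $t$-relaxed $k$-coloring is a map $f:V\to\{1,\dots,k\}$ such that every vertex $u$ has at most $t$ neighbors $v$ with $f(v)=f(u)$; $\chi_t(G)$ is the minimum such $k$. -}

module Defs where

open import Data.Nat using (ℕ; zero; suc; _≤_)
open import Data.Nat.Properties using (_≟_)
open import Data.Bool using (Bool; not)
open import Data.Fin using (Fin)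
import Data.Fin.Properties as FinP
open import Data.Fin.Subset using (Subset; _∈_; _⊆_; _∩_; _─_; ∣_∣; ⊤; Nonempty; Empty)
open import Data.Vec using (tabulate)
open import Data.Product using (Σ; _×_)
open import Relation.Nullary.Decidable using (⌊_⌋)

-- A complete multipartite graph on the vertex set Fin n is given by a
-- labelling  part : Fin n → ℕ  of vertices by their part; the parts are the
-- (nonempty) fibres of the labelling.  Every complete multipartite graph on Fin n
-- arises this way.

nbr : ∀ {n} → (Fin n → ℕ) → Fin n → Subset n
nbr part u = tabulate (λ v → not ⌊ part u ≟ part v ⌋)

Sparse : ∀ {n} → (Fin n → ℕ) → ℕ → Subset n → Set
Sparse part t S = ∀ u → u ∈ S → ∣ S ∩ nbr part u ∣ ≤ t

colourClass : ∀ {n k} → (Fin n → Fin k) → Fin n → Subset n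
colourClass f u = tabulate (λ v → ⌊ f v FinP.≟ f u ⌋)

IsRelaxedColouring : ∀ {n k} → (Fin n → ℕ) → ℕ → (Fin n → Fin k) → Set
IsRelaxedColouring part t f = ∀ u → ∣ colourClass f u ∩ nbr part u ∣ ≤ t

IsRelaxedChromaticNumber : ∀ {n} → (Fin n → ℕ) → ℕ → ℕ → Set
IsRelaxedChromaticNumber {n} part t k =
  (Σ (Fin n → Fin k) (IsRelaxedColouring part t)) ×
  (∀ j → (g : Fin n → Fin j) → IsRelaxedColouring part t g → k ≤ j)

IsMaxSparseIn : ∀ {n} → (Fin n → ℕ) → ℕ → Subset n → Subset n → Set
IsMaxSparseIn part t R S =
  (S ⊆ R) × Sparse part t S ×
  (∀ T → T ⊆ R → Sparse part t T → ∣ T ∣ ≤ ∣ S ∣)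

-- GreedyRun part t R k : some run of the greedy algorithm, started with the
-- set R of not-yet-coloured vertices, uses exactly k (new) colours.
data GreedyRun {n} (part : Fin n → ℕ) (t : ℕ) : Subset n → ℕ → Set where
  done : ∀ {R} → Empty R → GreedyRun part t R zero
  step : ∀ {R k} (S : Subset n) → Nonempty R → IsMaxSparseIn part t R S →
         GreedyRun part t (R ─ S) k → GreedyRun part t R (suc k)

-- The argument runs through the potential Φ(R) = Σ_P min(∣R ∩ P∣, 2), summed over the parts P.
-- In a complete multipartite graph a 1-sparse set either lies inside one part or is a single
-- edge, so deleting it lowers Φ by at most 2; since the colour classes of a 1-relaxed
-- j-colouring are 1-sparse, Φ(V) ≤ 2j.  Conversely, if a maximum 1-sparse set S of R does not
-- exhaust R, then ∣S∣ ≥ 2 and either S is all of R inside one part, or S is an edge and every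
-- part meets R in at most two vertices; either way deleting S lowers Φ by exactly 2.  So a
-- greedy run with k colours has 2k ≤ Φ(V) + 1, giving k ≤ j, and its colour classes form a
-- 1-relaxed k-colouring.

module Submission where

open import Defs
open import Data.Bool using (Bool; true; not)
open import Data.Fin using (Fin; zero; suc)
import Data.Fin.Properties as Fin
open import Data.Fin.Subset
  using (Subset; inside; outside; _∈_; _∉_; _⊆_; _∩_; _∪_; _─_; _-_; ⁅_⁆; ∣_∣; ⊤; ⊥; Nonempty; Empty)
open import Data.Fin.Subset.Properties
open import Data.Nat using (ℕ; zero; suc; _+_; _≤_; _<_; _>_; _⊓_; z≤n; s≤s; s≤s⁻¹)
open import Data.Nat.Properties
  using (_≟_; ≤-reflexive; ≤-trans; n≤1+n; m≤m+n; m≤n+m; +-suc; +-monoˡ-≤; +-monoʳ-≤;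
         <⇒≱; +-commutativeSemigroup; m≤n⇒m⊓n≡m; m≥n⇒m⊓n≡n; m⊓n≤n; ⊓-glb; ⊓-monoʳ-≤; module ≤-Reasoning)
open import Algebra.Properties.CommutativeSemigroup +-commutativeSemigroup using (x∙yz≈y∙xz)
open import Data.Product using (Σ; ∃; _×_; _,_; proj₁; proj₂)
open import Data.Sum using (_⊎_; inj₁; inj₂; [_,_]′)
open import Data.Vec using (_∷_; []; tabulate; here; there)
open import Data.Vec.Properties using (lookup∘tabulate; lookup⇒[]=; []=⇒lookup)
open import Function using (_∘_; id)
open import Relation.Binary.PropositionalEquality
open import Relation.Nullary using (yes; no; contradiction)
open import Relation.Nullary.Decidable using (⌊_⌋; isYes≗does; dec-true; dec-false; decidable-stable)
open import Relation.Unary using (Pred; Decidable)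

private
  variable
    n m k t : ℕ
    x y : Fin n
    p q r : Subset n

-- Finite subsets

∈-tabulate⁺ : {f : Fin n → Bool} → f x ≡ true → x ∈ tabulate f
∈-tabulate⁺ {x = x} {f = f} fx = lookup⇒[]= x (tabulate f) (trans (lookup∘tabulate f x) fx)

∈-tabulate⁻ : {f : Fin n → Bool} → x ∈ tabulate f → f x ≡ true
∈-tabulate⁻ {x = x} {f = f} x∈ = trans (sym (lookup∘tabulate f x)) ([]=⇒lookup x∈)

module _ {ℓ} {P : Pred (Fin n) ℓ} (P? : Decidable P) where

  ∈-tabulate⌊⌋⁺ : P x → x ∈ tabulate (λ y → ⌊ P? y ⌋)
  ∈-tabulate⌊⌋⁺ {x} px = ∈-tabulate⁺ (trans (isYes≗does (P? x)) (dec-true (P? x) px))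

  ∈-tabulate⌊⌋⁻ : x ∈ tabulate (λ y → ⌊ P? y ⌋) → P x
  ∈-tabulate⌊⌋⁻ {x} x∈ with P? x | ∈-tabulate⁻ x∈
  ... | yes px | _ = px

x∈p─q⇒x∉q : x ∈ p ─ q → x ∉ q
x∈p─q⇒x∉q {p = _ ∷ _} {q = inside ∷ _}  (there x∈p─q) (there x∈q) = x∈p─q⇒x∉q x∈p─q x∈q
x∈p─q⇒x∉q {p = _ ∷ _} {q = outside ∷ _} (there x∈p─q) (there x∈q) = x∈p─q⇒x∉q x∈p─q x∈q

x∉p⇒p-x≡p : x ∉ p → p - x ≡ p
x∉p⇒p-x≡p {x = x} {p = p} x∉p =
  ⊆-antisym (p─q⊆p p ⁅ x ⁆) (λ y∈p → x∈p∧x≢y⇒x∈p-y y∈p (λ { refl → x∉p y∈p }))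

p⊆q⇒p∪q≡q : p ⊆ q → p ∪ q ≡ q
p⊆q⇒p∪q≡q {p = p} {q = q} p⊆q = ⊆-antisym (λ x∈ → [ p⊆q , id ]′ (x∈p∪q⁻ p q x∈)) (q⊆p∪q p q)

p⊆r⇒q⊆r⇒p∪q⊆r : p ⊆ r → q ⊆ r → p ∪ q ⊆ r
p⊆r⇒q⊆r⇒p∪q⊆r {p = p} {q = q} p⊆r q⊆r x∈ = [ p⊆r , q⊆r ]′ (x∈p∪q⁻ p q x∈)

x∈p⇒⁅x⁆⊆p : x ∈ p → ⁅ x ⁆ ⊆ p
x∈p⇒⁅x⁆⊆p {x = x} {p = p} x∈p y∈ = subst (_∈ p) (sym (x∈⁅y⁆⇒x≡y x y∈)) x∈p

p⊆q⇒p∩r⊆q∩r : p ⊆ q → p ∩ r ⊆ q ∩ r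
p⊆q⇒p∩r⊆q∩r {p = p} {r = r} p⊆q x∈ = let (x∈p , x∈r) = x∈p∩q⁻ p r x∈ in x∈p∩q⁺ (p⊆q x∈p , x∈r)

p∩q─r≡p─r∩q : ∀ (p q r : Subset n) → p ∩ q ─ r ≡ (p ─ r) ∩ q
p∩q─r≡p─r∩q []      []      []            = refl
p∩q─r≡p─r∩q (_ ∷ p) (_ ∷ q) (inside ∷ r)  = cong (outside ∷_) (p∩q─r≡p─r∩q p q r)
p∩q─r≡p─r∩q (_ ∷ p) (_ ∷ q) (outside ∷ r) = cong (_ ∷_) (p∩q─r≡p─r∩q p q r)

disjoint⇒[p─r]∩q≡p∩q : (∀ {x} → x ∈ q → x ∉ r) → (p ─ r) ∩ q ≡ p ∩ q
disjoint⇒[p─r]∩q≡p∩q {q = q} {r = r} {p = p} disjoint = ⊆-antisym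
  (p⊆q⇒p∩r⊆q∩r (p─q⊆p p r))
  (λ x∈ → let (x∈p , x∈q) = x∈p∩q⁻ p q x∈ in x∈p∩q⁺ (x∈p∧x∉q⇒x∈p─q x∈p (disjoint x∈q) , x∈q))

x∈p⇒∣p∣≡1+∣p-x∣ : x ∈ p → ∣ p ∣ ≡ suc ∣ p - x ∣
x∈p⇒∣p∣≡1+∣p-x∣ {p = inside ∷ p}  here        = cong suc (cong ∣_∣ (sym (p─⊥≡p p)))
x∈p⇒∣p∣≡1+∣p-x∣ {p = inside ∷ p}  (there x∈p) = cong suc (x∈p⇒∣p∣≡1+∣p-x∣ x∈p)
x∈p⇒∣p∣≡1+∣p-x∣ {p = outside ∷ p} (there x∈p) = x∈p⇒∣p∣≡1+∣p-x∣ x∈p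

x∈p⇒∣p∣>0 : x ∈ p → ∣ p ∣ > 0
x∈p⇒∣p∣>0 x∈p = subst (_> 0) (sym (x∈p⇒∣p∣≡1+∣p-x∣ x∈p)) (s≤s z≤n)

∣p∣>0⇒Nonempty : 0 < ∣ p ∣ → Nonempty p
∣p∣>0⇒Nonempty {p = inside ∷ p}  _      = zero , here
∣p∣>0⇒Nonempty {p = outside ∷ p} ∣p∣>0 = let (x , x∈p) = ∣p∣>0⇒Nonempty ∣p∣>0 in suc x , there x∈p

x≢y⇒∣p∣≥2 : x ≢ y → x ∈ p → y ∈ p → 2 ≤ ∣ p ∣
x≢y⇒∣p∣≥2 x≢y x∈p y∈p =
  subst (2 ≤_) (sym (x∈p⇒∣p∣≡1+∣p-x∣ x∈p)) (s≤s (x∈p⇒∣p∣>0 (x∈p∧x≢y⇒x∈p-y y∈p (x≢y ∘ sym))))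

∣p∣≤1⇒x≡y : ∣ p ∣ ≤ 1 → x ∈ p → y ∈ p → x ≡ y
∣p∣≤1⇒x≡y {x = x} {y = y} ∣p∣≤1 x∈p y∈p =
  decidable-stable (x Fin.≟ y) (λ x≢y → <⇒≱ (x≢y⇒∣p∣≥2 x≢y x∈p y∈p) ∣p∣≤1)

∣p∪q∣≤∣p∣+∣q∣ : ∀ (p q : Subset n) → ∣ p ∪ q ∣ ≤ ∣ p ∣ + ∣ q ∣
∣p∪q∣≤∣p∣+∣q∣ []            []            = z≤n
∣p∪q∣≤∣p∣+∣q∣ (inside ∷ p)  (s ∷ q)       =
  s≤s (≤-trans (∣p∪q∣≤∣p∣+∣q∣ p q) (+-monoʳ-≤ ∣ p ∣ (∣p∣≤∣x∷p∣ s q)))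
∣p∪q∣≤∣p∣+∣q∣ (outside ∷ p) (inside ∷ q)  =
  ≤-trans (s≤s (∣p∪q∣≤∣p∣+∣q∣ p q)) (≤-reflexive (sym (+-suc ∣ p ∣ ∣ q ∣)))
∣p∪q∣≤∣p∣+∣q∣ (outside ∷ p) (outside ∷ q) = ∣p∪q∣≤∣p∣+∣q∣ p q

p─⁅x⁆∪⁅y⁆≡p-x-y : ∀ (p : Subset n) x y → p ─ (⁅ x ⁆ ∪ ⁅ y ⁆) ≡ p - x - y
p─⁅x⁆∪⁅y⁆≡p-x-y p x y = sym (p─q─r≡p─q∪r p ⁅ x ⁆ ⁅ y ⁆)

∣⁅x⁆∪⁅y⁆∣≤2 : ∀ (x y : Fin n) → ∣ ⁅ x ⁆ ∪ ⁅ y ⁆ ∣ ≤ 2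
∣⁅x⁆∪⁅y⁆∣≤2 x y =
  ≤-trans (∣p∪q∣≤∣p∣+∣q∣ ⁅ x ⁆ ⁅ y ⁆) (≤-reflexive (cong₂ _+_ (∣⁅x⁆∣≡1 x) (∣⁅x⁆∣≡1 y)))

-- The potential

fibre : (Fin n → ℕ) → ℕ → Subset n
fibre part a = tabulate (λ v → ⌊ part v ≟ a ⌋)

-- Φ R, computed by splitting off the part of the first vertex of R; by potential-split any
-- part can be split off first.
potential : (Fin n → ℕ) → Subset n → ℕ
potential {zero}  part []            = 0
potential {suc n} part (outside ∷ R) = potential (part ∘ suc) R
potential {suc n} part (inside ∷ R)  = suc ∣ R ∩ F ∣ ⊓ 2 + potential (part ∘ suc) (R ─ F)
  where F = fibre (part ∘ suc) (part zero)

potential-⊥ : ∀ (part : Fin n → ℕ) → potential part ⊥ ≡ 0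
potential-⊥ {zero}  part = refl
potential-⊥ {suc n} part = potential-⊥ (part ∘ suc)

fibres-disjoint : ∀ (part : Fin n → ℕ) {a b} → a ≢ b → x ∈ fibre part a → x ∉ fibre part b
fibres-disjoint part {a} {b} a≢b x∈a x∈b =
  a≢b (trans (sym (∈-tabulate⌊⌋⁻ (λ v → part v ≟ a) x∈a)) (∈-tabulate⌊⌋⁻ (λ v → part v ≟ b) x∈b))

potential-split : ∀ (part : Fin n → ℕ) a R →
  potential part R ≡ ∣ R ∩ fibre part a ∣ ⊓ 2 + potential part (R ─ fibre part a)
potential-split {zero}  part a []      = refl
potential-split {suc n} part a (x ∷ R) with part zero ≟ a
potential-split {suc n} part a (outside ∷ R) | yes refl = potential-split (part ∘ suc) a R
potential-split {suc n} part a (inside ∷ R)  | yes refl = refl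
potential-split {suc n} part a (outside ∷ R) | no _     = potential-split (part ∘ suc) a R
potential-split {suc n} part a (inside ∷ R)  | no b≢a   = begin
  suc ∣ R ∩ Fb ∣ ⊓ 2 + potential part′ (R ─ Fb)
    ≡⟨ cong (suc ∣ R ∩ Fb ∣ ⊓ 2 +_) (potential-split part′ a (R ─ Fb)) ⟩
  suc ∣ R ∩ Fb ∣ ⊓ 2 + (∣ (R ─ Fb) ∩ Fa ∣ ⊓ 2 + potential part′ (R ─ Fb ─ Fa))
    ≡⟨ cong₂ (λ X Y → suc ∣ R ∩ Fb ∣ ⊓ 2 + (∣ X ∣ ⊓ 2 + potential part′ Y))
             (disjoint⇒[p─r]∩q≡p∩q {p = R} (fibres-disjoint part′ (b≢a ∘ sym))) (p─q─r≡p─r─q R Fb Fa) ⟩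
  suc ∣ R ∩ Fb ∣ ⊓ 2 + (∣ R ∩ Fa ∣ ⊓ 2 + potential part′ (R ─ Fa ─ Fb))
    ≡⟨ x∙yz≈y∙xz (suc ∣ R ∩ Fb ∣ ⊓ 2) (∣ R ∩ Fa ∣ ⊓ 2) _ ⟩
  ∣ R ∩ Fa ∣ ⊓ 2 + (suc ∣ R ∩ Fb ∣ ⊓ 2 + potential part′ (R ─ Fa ─ Fb))
    ≡⟨ cong (λ X → ∣ R ∩ Fa ∣ ⊓ 2 + (suc ∣ X ∣ ⊓ 2 + potential part′ (R ─ Fa ─ Fb)))
            (sym (disjoint⇒[p─r]∩q≡p∩q {p = R} (fibres-disjoint part′ b≢a))) ⟩
  ∣ R ∩ Fa ∣ ⊓ 2 + (suc ∣ (R ─ Fa) ∩ Fb ∣ ⊓ 2 + potential part′ (R ─ Fa ─ Fb)) ∎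
  where
  open ≡-Reasoning
  part′ = part ∘ suc
  Fa = fibre part′ a
  Fb = fibre part′ (part zero)

-- Sparse sets of a complete multipartite graph

module _ {n : ℕ} (part : Fin n → ℕ) where

  private
    variable
      a : ℕ
      u v w : Fin n
      R S T : Subset n

  ∈-fibre⁺ : part v ≡ a → v ∈ fibre part a
  ∈-fibre⁺ {v} {a} = ∈-tabulate⌊⌋⁺ (λ w → part w ≟ a)

  ∈-fibre⁻ : v ∈ fibre part a → part v ≡ a
  ∈-fibre⁻ {v} {a} = ∈-tabulate⌊⌋⁻ (λ w → part w ≟ a)

  ∈-nbr⁺ : part u ≢ part v → v ∈ nbr part u
  ∈-nbr⁺ {u} {v} u≁v =
    ∈-tabulate⁺ (cong not (trans (isYes≗does (part u ≟ part v)) (dec-false (part u ≟ part v) u≁v)))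

  ∈-nbr⁻ : v ∈ nbr part u → part u ≢ part v
  ∈-nbr⁻ {v} {u} v∈ u∼v = contradiction (trans (sym (∈-tabulate⁻ v∈)) (cong not ⌊u∼v⌋≡true)) λ ()
    where ⌊u∼v⌋≡true = trans (isYes≗does (part u ≟ part v)) (dec-true (part u ≟ part v) u∼v)

  ⊆fibre⇒sparse : S ⊆ fibre part a → Sparse part t S
  ⊆fibre⇒sparse {S} S⊆F u u∈S =
    ≤-trans (≤-reflexive (trans (cong ∣_∣ (Empty-unique no-neighbour)) (∣⊥∣≡0 n))) z≤n
    where
    no-neighbour : Empty (S ∩ nbr part u)
    no-neighbour (v , v∈) =
      let (v∈S , v∈N) = x∈p∩q⁻ S _ v∈
      in ∈-nbr⁻ v∈N (trans (∈-fibre⁻ (S⊆F u∈S)) (sym (∈-fibre⁻ (S⊆F v∈S))))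

  ∣S∣≤1+t⇒sparse : ∣ S ∣ ≤ suc t → Sparse part t S
  ∣S∣≤1+t⇒sparse {S} {t} ∣S∣≤1+t u u∈S = s≤s⁻¹ (begin
    suc ∣ S ∩ nbr part u ∣ ≤⟨ s≤s (p⊆q⇒∣p∣≤∣q∣ S∩N⊆S-u) ⟩
    suc ∣ S - u ∣          ≡⟨ sym (x∈p⇒∣p∣≡1+∣p-x∣ u∈S) ⟩
    ∣ S ∣                  ≤⟨ ∣S∣≤1+t ⟩
    suc t                  ∎)
    where
    open ≤-Reasoning
    S∩N⊆S-u : S ∩ nbr part u ⊆ S - u
    S∩N⊆S-u v∈ =
      let (v∈S , v∈N) = x∈p∩q⁻ S _ v∈
      in x∈p∧x≢y⇒x∈p-y v∈S (λ v≡u → ∈-nbr⁻ v∈N (cong part (sym v≡u)))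

  ⊆fibre⊎∃-other-part : ∀ S u → S ⊆ fibre part (part u) ⊎ ∃ λ v → v ∈ S × part u ≢ part v
  ⊆fibre⊎∃-other-part S u with nonempty? (S ∩ nbr part u)
  ... | yes (v , v∈) = let (v∈S , v∈N) = x∈p∩q⁻ S _ v∈ in inj₂ (v , v∈S , ∈-nbr⁻ v∈N)
  ... | no  S∩N=∅ = inj₁ λ {w} w∈S → ∈-fibre⁺ (decidable-stable (part w ≟ part u)
                      λ w≁u → S∩N=∅ (w , x∈p∩q⁺ (w∈S , ∈-nbr⁺ (w≁u ∘ sym))))

  sparse-edge : Sparse part 1 S → u ∈ S → v ∈ S → part u ≢ part v → S ≡ ⁅ u ⁆ ∪ ⁅ v ⁆
  sparse-edge {S} {u} {v} S-sparse u∈S v∈S u≁v =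
    ⊆-antisym S⊆uv (p⊆r⇒q⊆r⇒p∪q⊆r (x∈p⇒⁅x⁆⊆p u∈S) (x∈p⇒⁅x⁆⊆p v∈S))
    where
    S⊆uv : S ⊆ ⁅ u ⁆ ∪ ⁅ v ⁆
    S⊆uv {w} w∈S with part w ≟ part u
    ... | yes w∼u = p⊆p∪q ⁅ v ⁆ (subst (_∈ ⁅ u ⁆) (sym w≡u) (x∈⁅x⁆ u))
      where
      w≡u = ∣p∣≤1⇒x≡y (S-sparse v v∈S)
              (x∈p∩q⁺ (w∈S , ∈-nbr⁺ (λ v∼w → u≁v (trans (sym w∼u) (sym v∼w)))))
              (x∈p∩q⁺ (u∈S , ∈-nbr⁺ (u≁v ∘ sym)))
    ... | no w≁u = q⊆p∪q ⁅ u ⁆ ⁅ v ⁆ (subst (_∈ ⁅ v ⁆) (sym w≡v) (x∈⁅x⁆ v))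
      where
      w≡v = ∣p∣≤1⇒x≡y (S-sparse u u∈S)
              (x∈p∩q⁺ (w∈S , ∈-nbr⁺ (w≁u ∘ sym)))
              (x∈p∩q⁺ (v∈S , ∈-nbr⁺ u≁v))

  potential-empty : Empty R → potential part R ≡ 0
  potential-empty R-empty = trans (cong (potential part) (Empty-unique R-empty)) (potential-⊥ part)

  potential-nonempty : Nonempty R → 1 ≤ potential part R
  potential-nonempty {R} (v , v∈R) = begin
    1                                     ≤⟨ ⊓-glb (x∈p⇒∣p∣>0 (x∈p∩q⁺ (v∈R , ∈-fibre⁺ refl))) (s≤s z≤n) ⟩
    ∣ R ∩ F ∣ ⊓ 2                         ≤⟨ m≤m+n _ _ ⟩
    ∣ R ∩ F ∣ ⊓ 2 + potential part (R ─ F) ≡⟨ potential-split part (part v) R ⟨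
    potential part R                      ∎
    where
    open ≤-Reasoning
    F = fibre part (part v)

  potential-split-─⊆fibre : ∀ R → T ⊆ fibre part a →
    potential part (R ─ T) ≡ ∣ (R ─ T) ∩ fibre part a ∣ ⊓ 2 + potential part (R ─ fibre part a)
  potential-split-─⊆fibre {T} {a} R T⊆F = trans (potential-split part a (R ─ T))
    (cong (λ X → ∣ (R ─ T) ∩ F ∣ ⊓ 2 + potential part X)
          (trans (p─q─r≡p─q∪r R T F) (cong (R ─_) (p⊆q⇒p∪q≡q T⊆F))))
    where F = fibre part a

  ∣R∩fibre∣≡1+∣[R-w]∩fibre∣ : w ∈ R →
    ∣ R ∩ fibre part (part w) ∣ ≡ suc ∣ (R - w) ∩ fibre part (part w) ∣
  ∣R∩fibre∣≡1+∣[R-w]∩fibre∣ {w} {R} w∈R =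
    trans (x∈p⇒∣p∣≡1+∣p-x∣ (x∈p∩q⁺ (w∈R , ∈-fibre⁺ refl)))
          (cong (suc ∘ ∣_∣) (p∩q─r≡p─r∩q R (fibre part (part w)) ⁅ w ⁆))

  potential-split-vertex : w ∈ R → potential part R ≡
    suc ∣ (R - w) ∩ fibre part (part w) ∣ ⊓ 2 + potential part (R ─ fibre part (part w))
  potential-split-vertex {w} {R} w∈R = trans (potential-split part (part w) R)
    (cong (λ c → c ⊓ 2 + potential part (R ─ fibre part (part w))) (∣R∩fibre∣≡1+∣[R-w]∩fibre∣ w∈R))

  potential≤1+potential[R-w] : ∀ R w → potential part R ≤ suc (potential part (R - w))
  potential≤1+potential[R-w] R w with w ∈? R
  ... | no w∉R = subst (λ X → potential part R ≤ suc (potential part X)) (sym (x∉p⇒p-x≡p w∉R)) (n≤1+n _)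
  ... | yes w∈R = begin
    potential part R             ≡⟨ potential-split-vertex w∈R ⟩
    suc c ⊓ 2 + X                ≤⟨ +-monoˡ-≤ X (s≤s (⊓-monoʳ-≤ c (s≤s z≤n))) ⟩
    suc (c ⊓ 2 + X)              ≡⟨ cong suc (potential-split-─⊆fibre R (x∈p⇒⁅x⁆⊆p (∈-fibre⁺ refl))) ⟨
    suc (potential part (R - w)) ∎
    where
    open ≤-Reasoning
    F = fibre part (part w)
    X = potential part (R ─ F)
    c = ∣ (R - w) ∩ F ∣

  potential≡1+potential[R-w] : w ∈ R → ∣ R ∩ fibre part (part w) ∣ ≤ 2 →
    potential part R ≡ suc (potential part (R - w))
  potential≡1+potential[R-w] {w} {R} w∈R ∣R∩F∣≤2 = begin
    potential part R             ≡⟨ potential-split-vertex w∈R ⟩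
    suc c ⊓ 2 + X                ≡⟨ cong (_+ X) (m≤n⇒m⊓n≡m 1+c≤2) ⟩
    suc c + X                    ≡⟨ cong (λ d → suc (d + X)) (m≤n⇒m⊓n≡m (≤-trans (n≤1+n c) 1+c≤2)) ⟨
    suc (c ⊓ 2 + X)              ≡⟨ cong suc (potential-split-─⊆fibre R (x∈p⇒⁅x⁆⊆p (∈-fibre⁺ refl))) ⟨
    suc (potential part (R - w)) ∎
    where
    open ≡-Reasoning
    F = fibre part (part w)
    X = potential part (R ─ F)
    c = ∣ (R - w) ∩ F ∣
    1+c≤2 : suc c ≤ 2
    1+c≤2 = subst (_≤ 2) (∣R∩fibre∣≡1+∣[R-w]∩fibre∣ w∈R) ∣R∩F∣≤2

  potential≤2+potential[R─T] : ∀ R → Sparse part 1 T → potential part R ≤ 2 + potential part (R ─ T)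
  potential≤2+potential[R─T] {T} R T-sparse with nonempty? T
  ... | no T-empty =
    subst (λ X → potential part R ≤ 2 + potential part X) (sym R─T≡R) (m≤n+m _ 2)
    where R─T≡R = trans (cong (R ─_) (Empty-unique T-empty)) (p─⊥≡p R)
  ... | yes (u , u∈T) with ⊆fibre⊎∃-other-part T u
  ...   | inj₁ T⊆F = begin
    potential part R                          ≡⟨ potential-split part (part u) R ⟩
    ∣ R ∩ F ∣ ⊓ 2 + X                          ≤⟨ +-monoˡ-≤ X (m⊓n≤n _ 2) ⟩
    2 + X                                     ≤⟨ +-monoʳ-≤ 2 (m≤n+m X _) ⟩
    2 + (∣ (R ─ T) ∩ F ∣ ⊓ 2 + X)              ≡⟨ cong (2 +_) (potential-split-─⊆fibre R T⊆F) ⟨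
    2 + potential part (R ─ T)                ∎
    where
    open ≤-Reasoning
    F = fibre part (part u)
    X = potential part (R ─ F)
  ...   | inj₂ (v , v∈T , u≁v) = begin
    potential part R                 ≤⟨ potential≤1+potential[R-w] R u ⟩
    suc (potential part (R - u))     ≤⟨ s≤s (potential≤1+potential[R-w] (R - u) v) ⟩
    2 + potential part (R - u - v)   ≡⟨ cong (λ X → 2 + potential part X) R─T≡R-u-v ⟨
    2 + potential part (R ─ T)       ∎
    where
    open ≤-Reasoning
    R─T≡R-u-v = trans (cong (R ─_) (sparse-edge T-sparse u∈T v∈T u≁v)) (p─⁅x⁆∪⁅y⁆≡p-x-y R u v)

  maximum-sparse-nonempty : IsMaxSparseIn part t R S → Nonempty R → Nonempty S
  maximum-sparse-nonempty {S = S} (_ , _ , S-largest) (y , y∈R) =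
    ∣p∣>0⇒Nonempty (subst (_≤ ∣ S ∣) (∣⁅x⁆∣≡1 y) (S-largest ⁅ y ⁆ (x∈p⇒⁅x⁆⊆p y∈R) ⁅y⁆-sparse))
    where ⁅y⁆-sparse = ∣S∣≤1+t⇒sparse (subst (_≤ _) (sym (∣⁅x⁆∣≡1 y)) (s≤s z≤n))

  maximum-sparse-∣∣≥2 : IsMaxSparseIn part 1 R S → Nonempty (R ─ S) → 2 ≤ ∣ S ∣
  maximum-sparse-∣∣≥2 {R} {S} S-max@(S⊆R , _ , S-largest) (y , y∈R─S)
    with s , s∈S ← maximum-sparse-nonempty S-max (y , p─q⊆p R S y∈R─S) = ≤-trans
      (x≢y⇒∣p∣≥2 s≢y (p⊆p∪q ⁅ y ⁆ (x∈⁅x⁆ s)) (q⊆p∪q ⁅ s ⁆ ⁅ y ⁆ (x∈⁅x⁆ y)))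
      (S-largest (⁅ s ⁆ ∪ ⁅ y ⁆) sy⊆R (∣S∣≤1+t⇒sparse (∣⁅x⁆∪⁅y⁆∣≤2 s y)))
    where
    sy⊆R = p⊆r⇒q⊆r⇒p∪q⊆r (x∈p⇒⁅x⁆⊆p (S⊆R s∈S)) (x∈p⇒⁅x⁆⊆p (p─q⊆p R S y∈R─S))
    s≢y : s ≢ y
    s≢y refl = x∈p─q⇒x∉q y∈R─S s∈S

  potential≡2+potential[R─S]-⊆fibre : IsMaxSparseIn part 1 R S → S ⊆ fibre part a → 2 ≤ ∣ S ∣ →
    potential part R ≡ 2 + potential part (R ─ S)
  potential≡2+potential[R─S]-⊆fibre {R} {S} {a} (S⊆R , _ , S-largest) S⊆F ∣S∣≥2 = begin
    potential part R                          ≡⟨ potential-split part a R ⟩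
    ∣ R ∩ F ∣ ⊓ 2 + X                          ≡⟨ cong (_+ X) (m≥n⇒m⊓n≡n (≤-trans ∣S∣≥2 ∣S∣≤∣R∩F∣)) ⟩
    2 + X                                     ≡⟨ cong (λ c → 2 + (c ⊓ 2 + X)) ∣[R─S]∩F∣≡0 ⟨
    2 + (∣ (R ─ S) ∩ F ∣ ⊓ 2 + X)              ≡⟨ cong (2 +_) (potential-split-─⊆fibre R S⊆F) ⟨
    2 + potential part (R ─ S)                ∎
    where
    open ≡-Reasoning
    F = fibre part a
    X = potential part (R ─ F)
    S⊆R∩F : S ⊆ R ∩ F
    S⊆R∩F x∈S = x∈p∩q⁺ (S⊆R x∈S , S⊆F x∈S)
    ∣S∣≤∣R∩F∣ = p⊆q⇒∣p∣≤∣q∣ S⊆R∩F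
    R∩F⊆S : R ∩ F ⊆ S
    R∩F⊆S {w} w∈ = decidable-stable (w ∈? S) λ w∉S →
      <⇒≱ (p⊂q⇒∣p∣<∣q∣ (S⊆R∩F , w , w∈ , w∉S)) (S-largest (R ∩ F) (p∩q⊆p R F) (⊆fibre⇒sparse (p∩q⊆q R F)))
    ∣[R─S]∩F∣≡0 : ∣ (R ─ S) ∩ F ∣ ≡ 0
    ∣[R─S]∩F∣≡0 = trans (cong ∣_∣ (Empty-unique λ (w , w∈) →
                    let (w∈R─S , w∈F) = x∈p∩q⁻ (R ─ S) F w∈
                    in x∈p─q⇒x∉q w∈R─S (R∩F⊆S (x∈p∩q⁺ (p─q⊆p R S w∈R─S , w∈F)))))
                  (∣⊥∣≡0 n)

  potential≡2+potential[R─S]-edge : IsMaxSparseIn part 1 R S → u ∈ S → v ∈ S → part u ≢ part v →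
    potential part R ≡ 2 + potential part (R ─ S)
  potential≡2+potential[R─S]-edge {R} {S} {u} {v} (S⊆R , S-sparse , S-largest) u∈S v∈S u≁v = begin
    potential part R                 ≡⟨ potential≡1+potential[R-w] (S⊆R u∈S) (fibres-small (part u)) ⟩
    suc (potential part (R - u))     ≡⟨ cong suc (potential≡1+potential[R-w] v∈R-u ∣[R-u]∩F∣≤2) ⟩
    2 + potential part (R - u - v)   ≡⟨ cong (λ X → 2 + potential part X) R─S≡R-u-v ⟨
    2 + potential part (R ─ S)       ∎
    where
    open ≡-Reasoning
    S≡uv = sparse-edge S-sparse u∈S v∈S u≁v
    R─S≡R-u-v = trans (cong (R ─_) S≡uv) (p─⁅x⁆∪⁅y⁆≡p-x-y R u v)
    fibres-small : ∀ a → ∣ R ∩ fibre part a ∣ ≤ 2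
    fibres-small a = ≤-trans (S-largest (R ∩ fibre part a) (p∩q⊆p R _) (⊆fibre⇒sparse (p∩q⊆q R _)))
                             (subst (λ X → ∣ X ∣ ≤ 2) (sym S≡uv) (∣⁅x⁆∪⁅y⁆∣≤2 u v))
    v∈R-u = x∈p∧x≢y⇒x∈p-y (S⊆R v∈S) (λ v≡u → u≁v (cong part (sym v≡u)))
    ∣[R-u]∩F∣≤2 = ≤-trans (p⊆q⇒∣p∣≤∣q∣ (p⊆q⇒p∩r⊆q∩r (p─q⊆p R ⁅ u ⁆))) (fibres-small (part v))

  potential≡2+potential[R─S] : IsMaxSparseIn part 1 R S → Nonempty (R ─ S) →
    potential part R ≡ 2 + potential part (R ─ S)
  potential≡2+potential[R─S] {R} {S} S-max R─S≠∅@(y , y∈R─S)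
    with u , u∈S ← maximum-sparse-nonempty S-max (y , p─q⊆p R S y∈R─S)
    with ⊆fibre⊎∃-other-part S u
  ... | inj₁ S⊆F              = potential≡2+potential[R─S]-⊆fibre S-max S⊆F (maximum-sparse-∣∣≥2 S-max R─S≠∅)
  ... | inj₂ (v , v∈S , u≁v) = potential≡2+potential[R─S]-edge S-max u∈S v∈S u≁v

  record SparseCover (t : ℕ) (R : Subset n) (m : ℕ) : Set where
    field
      block        : Fin m → Subset n
      block-sparse : ∀ i → Sparse part t (block i)
      covers       : v ∈ R → ∃ λ i → v ∈ block i

  open SparseCover

  greedyRun⇒sparseCover : GreedyRun part t R k → SparseCover t R k
  greedyRun⇒sparseCover (done R-empty) = record
    { block        = λ ()
    ; block-sparse = λ ()
    ; covers       = λ v∈R → contradiction (_ , v∈R) R-empty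
    }
  greedyRun⇒sparseCover {R = R} {k = suc k} (step S _ (_ , S-sparse , _) run) = record
    { block        = blocks
    ; block-sparse = λ { zero → S-sparse ; (suc i) → block-sparse C i }
    ; covers       = covers′
    }
    where
    C = greedyRun⇒sparseCover run
    blocks : Fin (suc k) → Subset n
    blocks zero    = S
    blocks (suc i) = block C i
    covers′ : v ∈ R → ∃ λ i → v ∈ blocks i
    covers′ {v} v∈R with v ∈? S
    ... | yes v∈S = zero , v∈S
    ... | no  v∉S = let (i , v∈) = covers C (x∈p∧x∉q⇒x∈p─q v∈R v∉S) in suc i , v∈

  sparseCover⇒relaxedColouring : SparseCover t ⊤ m → Σ (Fin n → Fin m) (IsRelaxedColouring part t)
  sparseCover⇒relaxedColouring {m = m} C = colour , λ u →
    ≤-trans (p⊆q⇒∣p∣≤∣q∣ (p⊆q⇒p∩r⊆q∩r (colourClass⊆block u)))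
            (block-sparse C (colour u) u (proj₂ (covers C ∈⊤)))
    where
    colour : Fin n → Fin m
    colour v = proj₁ (covers C (∈⊤ {x = v}))
    colourClass⊆block : ∀ u → colourClass colour u ⊆ block C (colour u)
    colourClass⊆block u {v} v∈ =
      subst (λ i → v ∈ block C i) (∈-tabulate⌊⌋⁻ (λ w → colour w Fin.≟ colour u) v∈) (proj₂ (covers C ∈⊤))

  relaxedColouring⇒sparseCover : (g : Fin n → Fin m) → IsRelaxedColouring part t g → SparseCover t ⊤ m
  relaxedColouring⇒sparseCover {m} {t} g g-relaxed = record
    { block        = colourSet
    ; block-sparse = λ i u u∈ → subst (λ j → ∣ colourSet j ∩ nbr part u ∣ ≤ t)
                                      (∈-tabulate⌊⌋⁻ (λ w → g w Fin.≟ i) u∈) (g-relaxed u)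
    ; covers       = λ {v} _ → g v , ∈-tabulate⌊⌋⁺ (λ w → g w Fin.≟ g v) refl
    }
    where
    colourSet : Fin m → Subset n
    colourSet i = tabulate (λ v → ⌊ g v Fin.≟ i ⌋)

  sparseCover⇒potential≤m+m : SparseCover 1 R m → potential part R ≤ m + m
  sparseCover⇒potential≤m+m {R} {zero} C = ≤-reflexive (potential-empty R-empty)
    where
    R-empty : Empty R
    R-empty (_ , v∈R) with () ← proj₁ (covers C v∈R)
  sparseCover⇒potential≤m+m {R} {suc m} C = begin
    potential part R                     ≤⟨ potential≤2+potential[R─T] R (block-sparse C zero) ⟩
    2 + potential part (R ─ block C zero) ≤⟨ +-monoʳ-≤ 2 (sparseCover⇒potential≤m+m rest) ⟩
    2 + (m + m)                          ≡⟨ cong suc (+-suc m m) ⟨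
    suc m + suc m                        ∎
    where
    open ≤-Reasoning
    rest : SparseCover 1 (R ─ block C zero) m
    rest = record { block = block C ∘ suc ; block-sparse = block-sparse C ∘ suc ; covers = covers′ }
      where
      covers′ : v ∈ R ─ block C zero → ∃ λ i → v ∈ block C (suc i)
      covers′ v∈ with covers C (p─q⊆p R _ v∈)
      ... | zero  , v∈B₀ = contradiction v∈B₀ (x∈p─q⇒x∉q v∈)
      ... | suc i , v∈Bᵢ = i , v∈Bᵢ

  greedyRun⇒k+k≤1+potential : GreedyRun part 1 R k → k + k ≤ suc (potential part R)
  greedyRun⇒k+k≤1+potential (done _) = z≤n
  greedyRun⇒k+k≤1+potential (step _ R≠∅ _ (done _)) = s≤s (potential-nonempty R≠∅)
  greedyRun⇒k+k≤1+potential {R} (step {k = suc k} S _ S-max run@(step _ R─S≠∅ _ _)) = begin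
    suc (suc k) + suc (suc k)          ≡⟨ cong suc (+-suc (suc k) (suc k)) ⟩
    suc (suc (suc k + suc k))          ≤⟨ s≤s (s≤s (greedyRun⇒k+k≤1+potential run)) ⟩
    suc (2 + potential part (R ─ S))   ≡⟨ cong suc (potential≡2+potential[R─S] S-max R─S≠∅) ⟨
    suc (potential part R)             ∎
    where open ≤-Reasoning

m+m≤1+n+n⇒m≤n : ∀ m n → m + m ≤ suc (n + n) → m ≤ n
m+m≤1+n+n⇒m≤n zero    n       _        = z≤n
m+m≤1+n+n⇒m≤n (suc m) zero    (s≤s le) = contradiction (subst (_≤ 0) (+-suc m m) le) λ ()
m+m≤1+n+n⇒m≤n (suc m) (suc n) (s≤s le) =
  s≤s (m+m≤1+n+n⇒m≤n m n (s≤s⁻¹ (subst₂ _≤_ (+-suc m m) (cong suc (+-suc n n)) le)))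

mainTheorem12 : ∀ (n : ℕ) (part : Fin n → ℕ) (k : ℕ) →
                GreedyRun part 1 ⊤ k → IsRelaxedChromaticNumber part 1 k
mainTheorem12 n part k run =
  sparseCover⇒relaxedColouring part (greedyRun⇒sparseCover part run) ,
  λ j g g-relaxed → m+m≤1+n+n⇒m≤n k j (≤-trans (greedyRun⇒k+k≤1+potential part run)
    (s≤s (sparseCover⇒potential≤m+m part (relaxedColouring⇒sparseCover part g g-relaxed))))
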